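{- If a finite graph $G$ contains no cycle $C_n$ (as a subgraph) for every $n\ge4$, then $ch(L(G))=\chi(L(G))$, where $L(G)$ is the line graph of $G$.
   Context: The choice number $ch(H)$ of a graph $H$ is the minimum $n$ such that for every assignment of sets $S(v)$ with $|S(v)|=n$ to the vertices of $H$ there is a proper vertex coloring assigning each $v$ a color from $S(v)$. $\chi$ denotes the chromatic number. -}

module Defs where

open import Data.Nat using (ℕ; zero; suc; _≤_)
open import Data.Fin using (Fin; zero; suc; inject₁; fromℕ)
open import Data.Bool using (Bool; true)
open import Data.Product using (Σ; _×_; _,_; proj₁; ∃)
open import Data.Sum using (_⊎_)
open import Data.List using (List; length)
open import Data.List.Membership.Propositional using (_∈_)
open import Data.List.Relation.Unary.Unique.Propositional using (Unique)
open import Data.Empty using (⊥)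
open import Relation.Nullary using (¬_)
open import Relation.Binary.PropositionalEquality using (_≡_; _≢_)
open import Function.Definitions using (Injective)

record SimpleGraph (n : ℕ) : Set where
  field
    adj    : Fin n → Fin n → Bool
    sym    : ∀ u v → adj u v ≡ adj v u
    irrefl : ∀ v → adj v v ≡ true → ⊥
open SimpleGraph public

-- G contains the cycle C_(suc m) as a subgraph: an injective cyclic
-- sequence of vertices f 0, f 1, …, f m with consecutive vertices adjacent
-- and f m adjacent to f 0.
HasCycle : ∀ {n} → SimpleGraph n → ℕ → Set
HasCycle {n} G zero = ⊥
HasCycle {n} G (suc m) =
  Σ (Fin (suc m) → Fin n) λ f →
    Injective _≡_ _≡_ f
    × (∀ (i : Fin m) → adj G (f (inject₁ i)) (f (suc i)) ≡ true)
    × adj G (f (fromℕ m)) (f zero) ≡ true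

-- Edges of G: ordered representatives (u , v) with u < v and uv ∈ E(G).
Edge : ∀ {n} → SimpleGraph n → Set
Edge {n} G = Σ (Fin n × Fin n) λ p →
  (Data.Fin._<_ (proj₁ p) (Data.Product.proj₂ p)) × adj G (proj₁ p) (Data.Product.proj₂ p) ≡ true

endpoints : ∀ {n} {G : SimpleGraph n} → Edge G → Fin n × Fin n
endpoints (p , _) = p

_incident_ : ∀ {n} → Fin n → Fin n × Fin n → Set
v incident (a , b) = (v ≡ a) ⊎ (v ≡ b)

LineAdj : ∀ {n} (G : SimpleGraph n) → Edge G → Edge G → Set
LineAdj {n} G e e' =
  endpoints {G = G} e ≢ endpoints {G = G} e'
  × ∃ λ (v : Fin n) → (v incident endpoints {G = G} e) × (v incident endpoints {G = G} e')

Proper : ∀ {V C : Set} → (V → V → Set) → (V → C) → Set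
Proper {V} R c = ∀ (x y : V) → R x y → c x ≢ c y

Colorable : (V : Set) → (V → V → Set) → ℕ → Set
Colorable V R k = Σ (V → Fin k) λ c → Proper R c

IsChromaticNumber : (V : Set) → (V → V → Set) → ℕ → Set
IsChromaticNumber V R k = Colorable V R k × (∀ j → Colorable V R j → k ≤ j)

Choosable : (V : Set) → (V → V → Set) → ℕ → Set
Choosable V R k =
  (S : V → List ℕ) → (∀ v → Unique (S v) × length (S v) ≡ k) →
  Σ (V → ℕ) λ c → (∀ v → c v ∈ S v) × Proper R c

IsChoiceNumber : (V : Set) → (V → V → Set) → ℕ → Set
IsChoiceNumber V R k = Choosable V R k × (∀ j → Choosable V R j → k ≤ j)

-- Choosability always implies colourability, so the content is the converse:
-- if L(G) has a proper k-colouring, then L(G) is k-choosable.  We prove it by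
-- induction on the number of edges of G, using the structure of graphs
-- without long cycles: every such graph with an edge has an edge ab that is
-- either pendant (a has no other neighbour) or lies in a pendant triangle abc
-- (a and b have no neighbours besides each other and c).  Deleting ab keeps
-- the hypotheses, and the edges of G ─ ab that meet ab see fewer than k
-- colours in any proper colouring of L(G ─ ab): at most deg(b) - 1 < k in
-- the pendant case (the edges at b form a clique of L(G)) and 2 < 3 ≤ k in
-- the triangle case.  Hence a list colouring of L(G ─ ab) extends greedily.
module Submission where

open import Defs renaming (sym to adj-sym)
open import Data.Nat as ℕ using (ℕ; zero; suc; _+_; _≤_; _<_; z≤n; s≤s)
open import Data.Nat.Properties using (<⇒≱; +-suc; 1+n≰n; ≤-trans; ≤-reflexive; m≤m+n)
open import Data.Nat.Induction using (<-wellFounded)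
open import Data.Fin using (Fin; zero; suc; inject₁; fromℕ; fromℕ<; toℕ)
open import Data.Fin.Properties using (injective⇒≤; toℕ-fromℕ<; <-cmp; <-asym; any?)
import Data.Fin.Properties as Fin
open import Data.Bool using (Bool; true; false)
import Data.Bool.Properties as Bool
open import Data.List using (List; []; _∷_; _++_; _∷ʳ_; length; lookup; filter; tabulate;
  allFin; upTo; cartesianProduct)
open import Data.List.Properties using (++-assoc; length-upTo; length-tabulate; length-++-sucʳ)
open import Data.List.Membership.Propositional using (_∈_; _∉_; lose)
open import Data.List.Membership.Propositional.Properties using (∈-lookup; ∈-upTo⁻;
  ∈-allFin; ∈-filter⁺; ∈-filter⁻; ∈-tabulate⁺; ∈-∃++; ∈-cartesianProduct⁺)
import Data.List.Membership.Setoid as SetoidMembership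
import Data.List.Membership.Setoid.Properties as SetoidMembership
import Data.List.Membership.DecPropositional as DecMembership
open import Data.List.Relation.Unary.Any using (here; there; index)
open import Data.List.Relation.Unary.Any.Properties using (lookup-index)
import Data.List.Relation.Unary.Any as Any
open import Data.List.Relation.Unary.All as All using (All; []; _∷_)
open import Data.List.Relation.Unary.All.Properties using (++⁻ˡ; ¬Any⇒All¬)
open import Data.List.Relation.Unary.AllPairs using (AllPairs; []; _∷_)
open import Data.List.Relation.Unary.Linked using (Linked; []; [-]; _∷_)
open import Data.List.Relation.Unary.Unique.Propositional using (Unique)
open import Data.List.Relation.Unary.Unique.Propositional.Properties using (upTo⁺; allFin⁺;
  filter⁺; cartesianProduct⁺)
open import Data.Product using (Σ; ∃; _×_; _,_; proj₁; proj₂; swap)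
open import Data.Product.Properties using (,-injectiveˡ; ,-injectiveʳ)
import Data.Product.Properties as Product
open import Data.Sum using (_⊎_; inj₁; inj₂)
open import Data.Empty using (⊥; ⊥-elim)
open import Function using (_∘_)
open import Function.Bundles using (_⇔_; mk⇔)
open import Function.Definitions using (Injective)
import Induction.WellFounded as WF
import Relation.Binary.Construct.On as On
open import Relation.Binary.Definitions using (DecidableEquality; tri<; tri≈; tri>)
open import Relation.Binary.PropositionalEquality using (_≡_; _≢_; refl; sym; trans; cong; subst;
  setoid)
open import Relation.Nullary using (¬_; Dec; yes; no; ¬?; _×-dec_; _⊎-dec_)
open import Relation.Nullary.Decidable using (decidable-stable)
open import Axiom.UniquenessOfIdentityProofs using (module Decidable⇒UIP)

module _ {A : Set} where

  lookup-injective : ∀ {xs : List A} → Unique xs → Injective _≡_ _≡_ (lookup xs)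
  lookup-injective {x ∷ xs} (x∉xs ∷ u) {zero}  {zero}  _  = refl
  lookup-injective {x ∷ xs} (x∉xs ∷ u) {zero}  {suc j} eq = ⊥-elim (All.lookup x∉xs (∈-lookup j) eq)
  lookup-injective {x ∷ xs} (x∉xs ∷ u) {suc i} {zero}  eq = ⊥-elim (All.lookup x∉xs (∈-lookup i) (sym eq))
  lookup-injective {x ∷ xs} (x∉xs ∷ u) {suc i} {suc j} eq = cong suc (lookup-injective u eq)

  unique-⊆-length : ∀ {xs ys : List A} → Unique xs → (∀ {x} → x ∈ xs → x ∈ ys) →
                    length xs ≤ length ys
  unique-⊆-length {xs} {ys} u xs⊆ys = injective⇒≤ position-injective
    where
    position : Fin (length xs) → Fin (length ys)
    position i = index (xs⊆ys (∈-lookup i))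
    position-injective : Injective _≡_ _≡_ position
    position-injective {i} {j} eq = lookup-injective u
      (SetoidMembership.index-injective (setoid A) (xs⊆ys (∈-lookup i)) (xs⊆ys (∈-lookup j)) eq)

module _ {A : Set} (_≟_ : DecidableEquality A) where
  open DecMembership _≟_ using (_∈?_)

  fresh : ∀ (S F : List A) → Unique S → length F < length S → ∃ λ x → x ∈ S × x ∉ F
  fresh S F u F<S with Any.any? (λ x → ¬? (x ∈? F)) S
  ... | yes avoiding = SetoidMembership.find (setoid A) avoiding
  ... | no  none     = ⊥-elim (<⇒≱ F<S (unique-⊆-length u S⊆F))
    where
    S⊆F : ∀ {x} → x ∈ S → x ∈ F
    S⊆F {x} x∈S = decidable-stable (x ∈? F) (λ x∉F → none (lose x∈S x∉F))

unique-Fin-length : ∀ {k} {xs : List (Fin k)} → Unique xs → length xs ≤ k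
unique-Fin-length u = injective⇒≤ (lookup-injective u)

module _ {A : Set} where

  -- The last entry of v ∷ ws ∷ʳ x, at the position where HasCycle looks for it.
  lookup-last : ∀ (v : A) ws x → lookup (v ∷ ws ∷ʳ x) (fromℕ (length (ws ∷ʳ x))) ≡ x
  lookup-last v []       x = refl
  lookup-last v (w ∷ ws) x = lookup-last w ws x

  -- Consecutive positions of a linked list are related, in the indexing of HasCycle.
  lookup-linked : ∀ {R : A → A → Set} {v vs} → Linked R (v ∷ vs) →
                  ∀ (i : Fin (length vs)) → R (lookup (v ∷ vs) (inject₁ i)) (lookup (v ∷ vs) (suc i))
  lookup-linked (vRw ∷ linked) zero    = vRw
  lookup-linked (vRw ∷ linked) (suc i) = lookup-linked linked i

  AllPairs-prefix : ∀ {R : A → A → Set} xs {w zs} → AllPairs R (xs ++ w ∷ zs) → AllPairs R (xs ∷ʳ w)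
  AllPairs-prefix []       (_ ∷ _)      = [] ∷ []
  AllPairs-prefix (x ∷ xs) {w} {zs} (Rx ∷ pairs) =
    ++⁻ˡ (xs ∷ʳ w) (subst (All _) (sym (++-assoc xs (w ∷ []) zs)) Rx) ∷ AllPairs-prefix xs pairs

  Linked-prefix : ∀ {R : A → A → Set} xs {w zs} → Linked R (xs ++ w ∷ zs) → Linked R (xs ∷ʳ w)
  Linked-prefix []           _              = [-]
  Linked-prefix (x ∷ [])     (xRw ∷ _)      = xRw ∷ [-]
  Linked-prefix (x ∷ y ∷ xs) (xRy ∷ linked) = xRy ∷ Linked-prefix (y ∷ xs) linked

module _ {V : Set} {R : V → V → Set} where

  clique-bound : ∀ {k} {c : V → Fin k} → Proper R c →
                 ∀ {m} (e : Fin m → V) → (∀ {i j} → i ≢ j → R (e i) (e j)) → m ≤ k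
  clique-bound {c = c} proper e clique = injective⇒≤ colour-injective
    where
    colour-injective : Injective _≡_ _≡_ (c ∘ e)
    colour-injective {i} {j} same =
      decidable-stable (i Fin.≟ j) (λ i≢j → proper (e i) (e j) (clique i≢j) same)

  -- Choosability implies colourability: give every vertex the list 0, …, k-1.
  choosable⇒colorable : ∀ k → Choosable V R k → Colorable V R k
  choosable⇒colorable k choose with choose (λ _ → upTo k) (λ _ → upTo⁺ k , length-upTo k)
  ... | c , c∈upTo , c-proper = (λ v → fromℕ< (c<k v)) , proper
    where
    c<k : ∀ v → c v < k
    c<k v = ∈-upTo⁻ (c∈upTo v)
    proper : Proper R (λ v → fromℕ< (c<k v))
    proper x y xRy same = c-proper x y xRy
      (trans (sym (toℕ-fromℕ< (c<k x))) (trans (cong toℕ same) (toℕ-fromℕ< (c<k y))))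

-- The graph (V, R)
-- consists of a copy ι of the graph (V', R') together with one more vertex x
-- (every vertex is x or in the image of ι).  If (V', R') is k-choosable and,
-- in each proper colouring of it, the neighbours of x use fewer than k
-- colours, then x can always be given a free colour from its list.
module OneVertexExtension
  {V V' : Set} (R : V → V → Set) (R' : V' → V' → Set) (x : V) (ι : V' → V)
  (split : ∀ v → v ≡ x ⊎ Σ V' λ v' → ι v' ≡ v)
  (R-sym : ∀ {u v} → R u v → R v u)
  (R-irrefl : ∀ {v} → ¬ R v v)
  (R-reflect : ∀ {u' v'} → R (ι u') (ι v') → R' u' v')
  where

  FewNeighbourColours : ℕ → Set
  FewNeighbourColours k = ∀ (c' : V' → ℕ) → Proper R' c' →
    ∃ λ F → length F < k × (∀ v' → R x (ι v') → c' v' ∈ F)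

  extend : ∀ {k} → Choosable V' R' k → FewNeighbourColours k → Choosable V R k
  extend choose' few S S-ok with choose' (S ∘ ι) (S-ok ∘ ι)
  ... | c' , c'∈S , c'-proper with few c' c'-proper
  ... | F , F<k , F-covers
        with fresh ℕ._≟_ (S x) F (proj₁ (S-ok x)) (subst (length F <_) (sym (proj₂ (S-ok x))) F<k)
  ... | cx , cx∈S , cx∉F = c , c∈S , c-proper
    where
    colour : ∀ {v} → v ≡ x ⊎ Σ V' (λ v' → ι v' ≡ v) → ℕ
    colour (inj₁ _)        = cx
    colour (inj₂ (v' , _)) = c' v'

    c : V → ℕ
    c v = colour (split v)

    c∈S : ∀ v → c v ∈ S v
    c∈S v with split v
    ... | inj₁ refl        = cx∈S
    ... | inj₂ (v' , refl) = c'∈S v'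

    c-proper : Proper R c
    c-proper u v uRv with split u | split v
    ... | inj₁ refl        | inj₁ refl        = ⊥-elim (R-irrefl uRv)
    ... | inj₁ refl        | inj₂ (v' , refl) = λ eq → cx∉F (subst (_∈ F) (sym eq) (F-covers v' uRv))
    ... | inj₂ (u' , refl) | inj₁ refl        = λ eq → cx∉F (subst (_∈ F) eq (F-covers u' (R-sym uRv)))
    ... | inj₂ (u' , refl) | inj₂ (v' , refl) = c'-proper u' v' (R-reflect uRv)

module _ {n : ℕ} where

  -- p and q are equal as unordered pairs.
  Same : Fin n × Fin n → Fin n × Fin n → Set
  Same p q = p ≡ q ⊎ p ≡ swap q

  Same? : ∀ p q → Dec (Same p q)
  Same? p q = (p ≟ q) ⊎-dec (p ≟ swap q)
    where
    _≟_ : DecidableEquality (Fin n × Fin n)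
    _≟_ = Product.≡-dec Fin._≟_ Fin._≟_

  Same-sym : ∀ {p q} → Same p q → Same q p
  Same-sym (inj₁ refl) = inj₁ refl
  Same-sym (inj₂ refl) = inj₂ refl

  Same-trans : ∀ {p q r} → Same p q → Same q r → Same p r
  Same-trans (inj₁ refl) q≈r         = q≈r
  Same-trans (inj₂ refl) (inj₁ refl) = inj₂ refl
  Same-trans (inj₂ refl) (inj₂ refl) = inj₁ refl

  incident-Same : ∀ {v p q} → v incident p → Same p q → v incident q
  incident-Same (inj₁ refl) (inj₁ refl) = inj₁ refl
  incident-Same (inj₂ refl) (inj₁ refl) = inj₂ refl
  incident-Same (inj₁ refl) (inj₂ refl) = inj₂ refl
  incident-Same (inj₂ refl) (inj₂ refl) = inj₁ refl

  other-ends-agree : ∀ {p p' v w w'} → Same p (v , w) → Same p' (v , w') → v ≢ w → p ≡ p' → w ≡ w'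
  other-ends-agree (inj₁ refl) (inj₁ refl) v≢w eq = ,-injectiveʳ eq
  other-ends-agree (inj₁ refl) (inj₂ refl) v≢w eq = ⊥-elim (v≢w (sym (,-injectiveʳ eq)))
  other-ends-agree (inj₂ refl) (inj₁ refl) v≢w eq = ⊥-elim (v≢w (sym (,-injectiveˡ eq)))
  other-ends-agree (inj₂ refl) (inj₂ refl) v≢w eq = ,-injectiveˡ eq

module Graph {n : ℕ} (G : SimpleGraph n) where

  Adj : Fin n → Fin n → Set
  Adj u v = adj G u v ≡ true

  adj? : ∀ u v → Dec (Adj u v)
  adj? u v = adj G u v Bool.≟ true

  Adj-sym : ∀ {u v} → Adj u v → Adj v u
  Adj-sym {u} {v} uv = trans (adj-sym G v u) uv

  Adj⇒≢ : ∀ {u v} → Adj u v → u ≢ v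
  Adj⇒≢ {u} uu refl = irrefl G u uu

  NoLongCycle : Set
  NoLongCycle = ∀ m → 4 ≤ m → ¬ HasCycle G m

  ends : Edge G → Fin n × Fin n
  ends = endpoints {G = G}

  edge-ext : ∀ (e e' : Edge G) → Same (ends e) (ends e') → e ≡ e'
  edge-ext (p , u<v , uv) (.p , u<v' , uv') (inj₁ refl)
    rewrite Fin.<-irrelevant u<v u<v' | Decidable⇒UIP.≡-irrelevant Bool._≟_ uv uv' = refl
  edge-ext ((u , v) , u<v , _) ((.v , .u) , v<u , _) (inj₂ refl) = ⊥-elim (<-asym u<v v<u)

  mkEdge : ∀ u v → Adj u v → Edge G
  mkEdge u v uv with <-cmp u v
  ... | tri< u<v _ _ = (u , v) , u<v , uv
  ... | tri≈ _ u≡v _ = ⊥-elim (Adj⇒≢ uv u≡v)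
  ... | tri> _ _ v<u = (v , u) , v<u , Adj-sym uv

  mkEdge-ends : ∀ u v (uv : Adj u v) → Same (ends (mkEdge u v uv)) (u , v)
  mkEdge-ends u v uv with <-cmp u v
  ... | tri< _ _ _   = inj₁ refl
  ... | tri≈ _ u≡v _ = ⊥-elim (Adj⇒≢ uv u≡v)
  ... | tri> _ _ _   = inj₂ refl

  mkEdge-unique : ∀ (e : Edge G) {u v} (uv : Adj u v) → Same (ends e) (u , v) → mkEdge u v uv ≡ e
  mkEdge-unique e {u} {v} uv e≈uv = edge-ext _ e (Same-trans (mkEdge-ends u v uv) (Same-sym e≈uv))

  other-end : ∀ (e : Edge G) {v} → v incident ends e → ∃ λ y → Adj v y × Same (ends e) (v , y)
  other-end ((u , w) , _ , uw) (inj₁ refl) = w , uw , inj₁ refl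
  other-end ((u , w) , _ , uw) (inj₂ refl) = u , Adj-sym uw , inj₂ refl

  LineAdj-sym : ∀ {e e'} → LineAdj G e e' → LineAdj G e' e
  LineAdj-sym (distinct , v , v∈e , v∈e') = (distinct ∘ sym) , v , v∈e' , v∈e

  LineAdj-irrefl : ∀ {e} → ¬ LineAdj G e e
  LineAdj-irrefl (distinct , _) = distinct refl

  star : ∀ {e e' v w w'} → Same (ends e) (v , w) → Same (ends e') (v , w') → Adj v w → w ≢ w' →
         LineAdj G e e'
  star e≈vw e'≈vw' vw w≢w' =
    (w≢w' ∘ other-ends-agree e≈vw e'≈vw' (Adj⇒≢ vw)) , _ ,
    incident-Same (inj₁ refl) (Same-sym e≈vw) , incident-Same (inj₁ refl) (Same-sym e'≈vw')

  neighbours : Fin n → List (Fin n)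
  neighbours v = filter (adj? v) (allFin n)

  neighbours-unique : ∀ v → Unique (neighbours v)
  neighbours-unique v = filter⁺ (adj? v) (allFin⁺ n)

  ∈-neighbours⁺ : ∀ {v w} → Adj v w → w ∈ neighbours v
  ∈-neighbours⁺ {v} {w} vw = ∈-filter⁺ (adj? v) (∈-allFin w) vw

  ∈-neighbours⁻ : ∀ {v w} → w ∈ neighbours v → Adj v w
  ∈-neighbours⁻ {v} w∈ = proj₂ (∈-filter⁻ (adj? v) {xs = allFin n} w∈)

  degree : Fin n → ℕ
  degree v = length (neighbours v)

  neighbour : ∀ v → Fin (degree v) → Fin n
  neighbour v = lookup (neighbours v)

  edgeAt : ∀ v → Fin (degree v) → Edge G
  edgeAt v i = mkEdge v (neighbour v i) (∈-neighbours⁻ (∈-lookup {xs = neighbours v} i))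

  edgeAt-surjective : ∀ (e : Edge G) {v} → v incident ends e → ∃ λ i → edgeAt v i ≡ e
  edgeAt-surjective e {v} v∈e with other-end e v∈e
  ... | y , vy , e≈vy =
    index y∈ , mkEdge-unique e _ (subst (λ z → Same (ends e) (v , z)) (lookup-index y∈) e≈vy)
    where
    y∈ : y ∈ neighbours v
    y∈ = ∈-neighbours⁺ vy

  edgeAt-clique : ∀ v {i j} → i ≢ j → LineAdj G (edgeAt v i) (edgeAt v j)
  edgeAt-clique v {i} {j} i≢j =
    star {edgeAt v i} {edgeAt v j} (mkEdge-ends v _ (vw i)) (mkEdge-ends v _ (vw j)) (vw i)
      (i≢j ∘ lookup-injective (neighbours-unique v))
    where
    vw : ∀ k → Adj v (neighbour v k)
    vw k = ∈-neighbours⁻ (∈-lookup {xs = neighbours v} k)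


  triangle-bound : ∀ {k} {col : Edge G → Fin k} → Proper (LineAdj G) col →
                   ∀ {a b c} → Adj a b → Adj a c → Adj b c → 3 ≤ k
  triangle-bound proper {a} {b} {c} ab ac bc = clique-bound proper triangle clique
    where
    triangle : Fin 3 → Edge G
    triangle zero             = mkEdge a b ab
    triangle (suc zero)       = mkEdge a c ac
    triangle (suc (suc zero)) = mkEdge b c bc

    ab~ac : LineAdj G (triangle zero) (triangle (suc zero))
    ab~ac = star {triangle zero} {triangle (suc zero)} (mkEdge-ends a b ab) (mkEdge-ends a c ac) ab
      (Adj⇒≢ bc)
    ab~bc : LineAdj G (triangle zero) (triangle (suc (suc zero)))
    ab~bc = star {triangle zero} {triangle (suc (suc zero))} (Same-trans (mkEdge-ends a b ab) (inj₂ refl))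
      (mkEdge-ends b c bc) (Adj-sym ab) (Adj⇒≢ ac)
    ac~bc : LineAdj G (triangle (suc zero)) (triangle (suc (suc zero)))
    ac~bc = star {triangle (suc zero)} {triangle (suc (suc zero))}
      (Same-trans (mkEdge-ends a c ac) (inj₂ refl)) (Same-trans (mkEdge-ends b c bc) (inj₂ refl))
      (Adj-sym ac) (Adj⇒≢ ab)

    clique : ∀ {i j} → i ≢ j → LineAdj G (triangle i) (triangle j)
    clique {zero}           {suc zero}       _   = ab~ac
    clique {zero}           {suc (suc zero)} _   = ab~bc
    clique {suc zero}       {suc (suc zero)} _   = ac~bc
    clique {suc zero}       {zero}           _   = LineAdj-sym {triangle zero} {triangle (suc zero)} ab~ac
    clique {suc (suc zero)} {zero}           _   =
      LineAdj-sym {triangle zero} {triangle (suc (suc zero))} ab~bc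
    clique {suc (suc zero)} {suc zero}       _   =
      LineAdj-sym {triangle (suc zero)} {triangle (suc (suc zero))} ac~bc
    clique {zero}           {zero}           i≢j = ⊥-elim (i≢j refl)
    clique {suc zero}       {suc zero}       i≢j = ⊥-elim (i≢j refl)
    clique {suc (suc zero)} {suc (suc zero)} i≢j = ⊥-elim (i≢j refl)

  arc? : ∀ p → Dec (Adj (proj₁ p) (proj₂ p))
  arc? (u , v) = adj? u v

  arcs : List (Fin n × Fin n)
  arcs = filter arc? (cartesianProduct (allFin n) (allFin n))

  arcs-unique : Unique arcs
  arcs-unique = filter⁺ arc? (cartesianProduct⁺ (allFin⁺ n) (allFin⁺ n))

  ∈-arcs⁺ : ∀ {u v} → Adj u v → (u , v) ∈ arcs
  ∈-arcs⁺ {u} {v} uv = ∈-filter⁺ arc? (∈-cartesianProduct⁺ (∈-allFin u) (∈-allFin v)) uv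

  ∈-arcs⁻ : ∀ {p} → p ∈ arcs → Adj (proj₁ p) (proj₂ p)
  ∈-arcs⁻ p∈ = proj₂ (∈-filter⁻ arc? {xs = cartesianProduct (allFin n) (allFin n)} p∈)

  edgeless-choosable : ¬ (∃ λ u → ∃ λ v → Adj u v) → ∀ {k} → Choosable (Edge G) (LineAdj G) k
  edgeless-choosable edgeless _ _ =
    (λ e → ⊥-elim (no-edge e)) , (λ e → ⊥-elim (no-edge e)) , (λ e → ⊥-elim (no-edge e))
    where
    no-edge : Edge G → ⊥
    no-edge ((u , v) , _ , uv) = edgeless (u , v , uv)

module Structure {n : ℕ} (G : SimpleGraph n) where
  open Graph G
  open DecMembership (Fin._≟_ {n}) using (_∈?_)

  Path : List (Fin n) → Set
  Path P = Unique P × Linked Adj P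

  close : ∀ v ws x → Path (v ∷ ws ∷ʳ x) → Adj x v → HasCycle G (suc (length (ws ∷ʳ x)))
  close v ws x (distinct , linked) xv =
    lookup (v ∷ ws ∷ʳ x) , lookup-injective distinct , lookup-linked linked ,
    subst (λ y → Adj y v) (sym (lookup-last v ws x)) xv

  -- A chord from the first vertex v₀ of a path v₀ v₁ v₂ … to a later vertex
  -- would close a cycle of length at least 4.
  no-long-chord : NoLongCycle → ∀ {v₀ v₁ v₂ r x} → Path (v₀ ∷ v₁ ∷ v₂ ∷ r) → x ∈ r → ¬ Adj v₀ x
  no-long-chord noLong {v₀} {v₁} {v₂} {x = x} (distinct , linked) x∈r v₀x with ∈-∃++ x∈r
  ... | ys , zs , refl = noLong _ long (close v₀ (v₁ ∷ v₂ ∷ ys) x prefix (Adj-sym v₀x))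
    where
    prefix : Path (v₀ ∷ v₁ ∷ v₂ ∷ ys ∷ʳ x)
    prefix = AllPairs-prefix (v₀ ∷ v₁ ∷ v₂ ∷ ys) distinct , Linked-prefix (v₀ ∷ v₁ ∷ v₂ ∷ ys) linked
    long : 4 ≤ suc (length (v₁ ∷ v₂ ∷ ys ∷ʳ x))
    long = s≤s (s≤s (s≤s (subst (1 ≤_) (sym (length-++-sucʳ ys x [])) (s≤s z≤n))))

  end-neighbours : NoLongCycle → ∀ {v₀ v₁ v₂ r} → Path (v₀ ∷ v₁ ∷ v₂ ∷ r) →
                   (∀ x → Adj v₀ x → x ∈ v₀ ∷ v₁ ∷ v₂ ∷ r) → ∀ x → Adj v₀ x → x ≡ v₁ ⊎ x ≡ v₂
  end-neighbours noLong path on-path x v₀x with on-path x v₀x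
  ... | here refl                 = ⊥-elim (Adj⇒≢ v₀x refl)
  ... | there (here x≡v₁)         = inj₁ x≡v₁
  ... | there (there (here x≡v₂)) = inj₂ x≡v₂
  ... | there (there (there x∈r)) = ⊥-elim (no-long-chord noLong path x∈r v₀x)

  -- An edge ab whose deletion can be undone by greedy list colouring.
  data Reducible : Set where
    pendant  : ∀ {a b} → Adj a b → (∀ x → Adj a x → x ≡ b) → Reducible
    triangle : ∀ {a b c} → Adj a b → Adj a c → Adj b c →
               (∀ x → Adj a x → x ≡ b ⊎ x ≡ c) → (∀ x → Adj b x → x ≡ a ⊎ x ≡ c) → Reducible

  grow-or-stuck : ∀ v P → (∃ λ x → Adj v x × x ∉ P) ⊎ (∀ x → Adj v x → x ∈ P)
  grow-or-stuck v P with any? (λ x → adj? v x ×-dec ¬? (x ∈? P))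
  ... | yes (x , vx , x∉P) = inj₁ (x , vx , x∉P)
  ... | no  none           = inj₂ λ x vx → decidable-stable (x ∈? P) (λ x∉P → none (x , vx , x∉P))

  prepend : ∀ {x v P} → Adj x v → x ∉ v ∷ P → Path (v ∷ P) → Path (x ∷ v ∷ P)
  prepend {v = v} {P = P} xv x∉ (distinct , linked) = ¬Any⇒All¬ (v ∷ P) x∉ ∷ distinct , xv ∷ linked

  swap-path : ∀ {v₀ v₁ v₂ r} → Adj v₀ v₂ → Path (v₀ ∷ v₁ ∷ v₂ ∷ r) → Path (v₁ ∷ v₀ ∷ v₂ ∷ r)
  swap-path v₀v₂ (((v₀≢v₁ ∷ v₀∉) ∷ v₁∉ ∷ distinct) , v₀v₁ ∷ _ ∷ linked) =
    ((v₀≢v₁ ∘ sym) ∷ v₁∉) ∷ v₀∉ ∷ distinct , Adj-sym v₀v₁ ∷ v₀v₂ ∷ linked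

  -- A path has at most n vertices, so a path that can still grow must
  -- have spare room in the budget n ≤ fuel + length P.
  out-of-fuel : ∀ {x P} → Unique (x ∷ P) → ¬ (n ≤ length P)
  out-of-fuel distinct bound = 1+n≰n (≤-trans (unique-Fin-length distinct) bound)

  spend : ∀ f {x : Fin n} P → n ≤ suc f + length P → n ≤ f + length (x ∷ P)
  spend f P bound = ≤-trans bound (≤-reflexive (sym (+-suc f (length P))))

  -- Grow a maximal path v₀ v₁ … at its first vertex.  When v₀ is stuck, its
  -- neighbours are v₁ and possibly v₂; in the latter case v₁ v₀ v₂ … is a
  -- path too, and we try to grow it at v₁.  If v₁ is stuck as well, the
  -- triangle v₀ v₁ v₂ is pendant.
  search : NoLongCycle → ∀ fuel v₀ v₁ r → Path (v₀ ∷ v₁ ∷ r) → n ≤ fuel + length (v₀ ∷ v₁ ∷ r) →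
           Reducible
  search noLong fuel v₀ v₁ r path bound with grow-or-stuck v₀ (v₀ ∷ v₁ ∷ r)
  search noLong zero v₀ v₁ r path bound | inj₁ (x , v₀x , x∉) =
    ⊥-elim (out-of-fuel (proj₁ (prepend (Adj-sym v₀x) x∉ path)) bound)
  search noLong (suc f) v₀ v₁ r path bound | inj₁ (x , v₀x , x∉) =
    search noLong f x v₀ (v₁ ∷ r) (prepend (Adj-sym v₀x) x∉ path) (spend f {x} (v₀ ∷ v₁ ∷ r) bound)
  search noLong fuel v₀ v₁ [] path@(_ , v₀v₁ ∷ _) bound | inj₂ stuck = pendant v₀v₁ only-v₁
    where
    only-v₁ : ∀ x → Adj v₀ x → x ≡ v₁
    only-v₁ x v₀x with stuck x v₀x
    ... | here refl         = ⊥-elim (Adj⇒≢ v₀x refl)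
    ... | there (here x≡v₁) = x≡v₁
  search noLong fuel v₀ v₁ (v₂ ∷ r) path@(_ , v₀v₁ ∷ v₁v₂ ∷ _) bound | inj₂ stuck with adj? v₀ v₂
  ... | no ¬v₀v₂ = pendant v₀v₁ only-v₁
    where
    only-v₁ : ∀ x → Adj v₀ x → x ≡ v₁
    only-v₁ x v₀x with end-neighbours noLong path stuck x v₀x
    ... | inj₁ x≡v₁ = x≡v₁
    ... | inj₂ refl = ⊥-elim (¬v₀v₂ v₀x)
  ... | yes v₀v₂ with grow-or-stuck v₁ (v₁ ∷ v₀ ∷ v₂ ∷ r)
  search noLong zero v₀ v₁ (v₂ ∷ r) path bound | inj₂ stuck | yes v₀v₂ | inj₁ (x , v₁x , x∉) =
    ⊥-elim (out-of-fuel (proj₁ (prepend (Adj-sym v₁x) x∉ (swap-path v₀v₂ path))) bound)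
  search noLong (suc f) v₀ v₁ (v₂ ∷ r) path bound | inj₂ stuck | yes v₀v₂ | inj₁ (x , v₁x , x∉) =
    search noLong f x v₁ (v₀ ∷ v₂ ∷ r) (prepend (Adj-sym v₁x) x∉ (swap-path v₀v₂ path))
      (spend f {x} (v₁ ∷ v₀ ∷ v₂ ∷ r) bound)
  search noLong fuel v₀ v₁ (v₂ ∷ r) path@(_ , v₀v₁ ∷ v₁v₂ ∷ _) bound | inj₂ stuck | yes v₀v₂ | inj₂ stuck′ =
    triangle v₀v₁ v₀v₂ v₁v₂ (end-neighbours noLong path stuck)
      (end-neighbours noLong (swap-path v₀v₂ path) stuck′)

  find-reducible : NoLongCycle → ∀ {u v} → Adj u v → Reducible
  find-reducible noLong {u} {v} uv =
    search noLong n u v [] (((Adj⇒≢ uv ∷ []) ∷ [] ∷ []) , uv ∷ [-]) (m≤m+n n 2)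

module Deletion {n : ℕ} (G : SimpleGraph n) {a b : Fin n} (ab : Graph.Adj G a b) where
  open Graph G

  adj′ : Fin n → Fin n → Bool
  adj′ u v with Same? (u , v) (a , b)
  ... | yes _ = false
  ... | no  _ = adj G u v

  adj′-sym : ∀ u v → adj′ u v ≡ adj′ v u
  adj′-sym u v with Same? (u , v) (a , b) | Same? (v , u) (a , b)
  ... | yes _     | yes _     = refl
  ... | yes uv≈ab | no ¬vu≈ab = ⊥-elim (¬vu≈ab (Same-trans (inj₂ refl) uv≈ab))
  ... | no ¬uv≈ab | yes vu≈ab = ⊥-elim (¬uv≈ab (Same-trans (inj₂ refl) vu≈ab))
  ... | no _      | no _      = adj-sym G u v

  adj′-irrefl : ∀ v → adj′ v v ≡ true → ⊥
  adj′-irrefl v with Same? (v , v) (a , b)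
  ... | yes _ = λ ()
  ... | no  _ = irrefl G v

  G′ : SimpleGraph n
  G′ = record { adj = adj′ ; sym = adj′-sym ; irrefl = adj′-irrefl }

  module G′ = Graph G′

  G′⇒G : ∀ {u v} → G′.Adj u v → Adj u v
  G′⇒G {u} {v} with Same? (u , v) (a , b)
  ... | yes _ = λ ()
  ... | no  _ = λ uv → uv

  G′⇒≉ab : ∀ {u v} → G′.Adj u v → ¬ Same (u , v) (a , b)
  G′⇒≉ab {u} {v} with Same? (u , v) (a , b)
  ... | yes _     = λ ()
  ... | no ¬uv≈ab = λ _ → ¬uv≈ab

  G⇒G′ : ∀ {u v} → ¬ Same (u , v) (a , b) → Adj u v → G′.Adj u v
  G⇒G′ {u} {v} ¬uv≈ab uv with Same? (u , v) (a , b)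
  ... | yes uv≈ab = ⊥-elim (¬uv≈ab uv≈ab)
  ... | no  _     = uv

  fewer-arcs : length G′.arcs < length arcs
  fewer-arcs = unique-⊆-length {xs = (a , b) ∷ G′.arcs} (ab∉ ∷ G′.arcs-unique) ⊆arcs
    where
    ab∉ : All ((a , b) ≢_) G′.arcs
    ab∉ = All.tabulate λ p∈ ab≡p → G′⇒≉ab (G′.∈-arcs⁻ p∈) (inj₁ (sym ab≡p))
    ⊆arcs : ∀ {p} → p ∈ (a , b) ∷ G′.arcs → p ∈ arcs
    ⊆arcs (here refl) = ∈-arcs⁺ ab
    ⊆arcs (there p∈)  = ∈-arcs⁺ (G′⇒G (G′.∈-arcs⁻ p∈))

  -- A cycle of G ─ ab is a cycle of G.
  noLongCycle′ : NoLongCycle → G′.NoLongCycle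
  noLongCycle′ noLong (suc m) 4≤m (f , f-injective , steps , closing) =
    noLong (suc m) 4≤m (f , f-injective , G′⇒G ∘ steps , G′⇒G closing)

  ι : Edge G′ → Edge G
  ι (p , p< , uv) = p , p< , G′⇒G uv

  e₀ : Edge G
  e₀ = mkEdge a b ab

  split : ∀ e → e ≡ e₀ ⊎ Σ (Edge G′) λ e′ → ι e′ ≡ e
  split e@((u , v) , u<v , uv) with Same? (u , v) (a , b)
  ... | yes uv≈ab = inj₁ (sym (mkEdge-unique e ab uv≈ab))
  ... | no ¬uv≈ab = inj₂ (((u , v) , u<v , G⇒G′ ¬uv≈ab uv) , edge-ext _ e (inj₁ refl))

  restrict : ∀ {k} → Colorable (Edge G) (LineAdj G) k → Colorable (Edge G′) (LineAdj G′) k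
  restrict (c , proper) = c ∘ ι , λ e f e~f → proper (ι e) (ι f) e~f

  open OneVertexExtension (LineAdj G) (LineAdj G′) e₀ ι split
    (λ {e} {f} → LineAdj-sym {e} {f}) (λ {e} → LineAdj-irrefl {e}) (λ e~f → e~f) public

  meets-ab : ∀ {e′} → LineAdj G e₀ (ι e′) → ∃ λ v → (v ≡ a ⊎ v ≡ b) × v incident G′.ends e′
  meets-ab (_ , v , v∈e₀ , v∈e′) = v , incident-Same v∈e₀ (mkEdge-ends a b ab) , v∈e′

  ≉ab : ∀ (e′ : Edge G′) → ¬ Same (G′.ends e′) (a , b)
  ≉ab (_ , _ , uv) = G′⇒≉ab uv

  -- Pendant case (a is a leaf at b): the edges meeting ab are the edges of
  -- G ─ ab at b.  Together with ab they form a clique of L(G), so a proper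
  -- k-colouring of L(G) shows that there are fewer than k of them.
  pendant-colours : ∀ {k} → Colorable (Edge G) (LineAdj G) k → (∀ x → Adj a x → x ≡ b) →
                    FewNeighbourColours k
  pendant-colours {k} (_ , proper) leaf c′ _ = tabulate (c′ ∘ G′.edgeAt b) , few , covers
    where
    b-edge : Fin (suc (G′.degree b)) → Edge G
    b-edge zero    = e₀
    b-edge (suc i) = ι (G′.edgeAt b i)

    e₀~b-edge : ∀ i → LineAdj G e₀ (b-edge (suc i))
    e₀~b-edge i = star {e₀} {b-edge (suc i)} (Same-trans (mkEdge-ends a b ab) (inj₂ refl))
      (G′.mkEdge-ends b _ bw) (Adj-sym ab)
      (λ a≡w → G′⇒≉ab {b} {a} (subst (G′.Adj b) (sym a≡w) bw) (inj₂ refl))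
      where
      bw : G′.Adj b (G′.neighbour b i)
      bw = G′.∈-neighbours⁻ {b} (∈-lookup {xs = G′.neighbours b} i)

    clique : ∀ {i j} → i ≢ j → LineAdj G (b-edge i) (b-edge j)
    clique {zero}  {zero}  i≢j = ⊥-elim (i≢j refl)
    clique {zero}  {suc j} _   = e₀~b-edge j
    clique {suc i} {zero}  _   = LineAdj-sym {e₀} {b-edge (suc i)} (e₀~b-edge i)
    clique {suc i} {suc j} i≢j = G′.edgeAt-clique b (i≢j ∘ cong suc)

    few : length (tabulate (c′ ∘ G′.edgeAt b)) < k
    few = subst (_< k) (sym (length-tabulate (c′ ∘ G′.edgeAt b))) (clique-bound proper b-edge clique)

    covers : ∀ e′ → LineAdj G e₀ (ι e′) → c′ e′ ∈ tabulate (c′ ∘ G′.edgeAt b)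
    covers e′ e₀~e′ with meets-ab {e′} e₀~e′
    ... | v , inj₁ refl , a∈e′ with G′.other-end e′ a∈e′
    ...   | y , ay , e′≈ay rewrite leaf y (G′⇒G ay) = ⊥-elim (≉ab e′ e′≈ay)
    covers e′ e₀~e′ | v , inj₂ refl , b∈e′ with G′.edgeAt-surjective e′ b∈e′
    ...   | i , refl = ∈-tabulate⁺ i

  -- Triangle case (a and b have no neighbours besides each other and c):
  -- the edges meeting ab are ac and bc, and the triangle abc is a clique of
  -- L(G), so 2 < 3 ≤ k.
  triangle-colours : ∀ {k c} → Colorable (Edge G) (LineAdj G) k → (ac : Adj a c) (bc : Adj b c) →
                     (∀ x → Adj a x → x ≡ b ⊎ x ≡ c) → (∀ x → Adj b x → x ≡ a ⊎ x ≡ c) →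
                     FewNeighbourColours k
  triangle-colours {c = c} (_ , proper) ac bc a-nbrs b-nbrs c′ _ =
    c′ ac′ ∷ c′ bc′ ∷ [] , triangle-bound proper ab ac bc , covers
    where
    ac′ : Edge G′
    ac′ = G′.mkEdge a c (G⇒G′ ac≉ab ac)
      where
      ac≉ab : ¬ Same (a , c) (a , b)
      ac≉ab (inj₁ ac≡ab) = Adj⇒≢ bc (sym (,-injectiveʳ ac≡ab))
      ac≉ab (inj₂ ac≡ba) = Adj⇒≢ ab (,-injectiveˡ ac≡ba)

    bc′ : Edge G′
    bc′ = G′.mkEdge b c (G⇒G′ bc≉ab bc)
      where
      bc≉ab : ¬ Same (b , c) (a , b)
      bc≉ab (inj₁ bc≡ab) = Adj⇒≢ ab (sym (,-injectiveˡ bc≡ab))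
      bc≉ab (inj₂ bc≡ba) = Adj⇒≢ ac (sym (,-injectiveʳ bc≡ba))

    covers : ∀ e′ → LineAdj G e₀ (ι e′) → c′ e′ ∈ c′ ac′ ∷ c′ bc′ ∷ []
    covers e′ e₀~e′ with meets-ab {e′} e₀~e′
    ... | v , inj₁ refl , a∈e′ with G′.other-end e′ a∈e′
    ...   | y , ay , e′≈ay with a-nbrs y (G′⇒G ay)
    ...     | inj₁ refl = ⊥-elim (≉ab e′ e′≈ay)
    ...     | inj₂ refl = here (cong c′ (sym (G′.mkEdge-unique e′ _ e′≈ay)))
    covers e′ e₀~e′ | v , inj₂ refl , b∈e′ with G′.other-end e′ b∈e′
    ...   | y , by , e′≈by with b-nbrs y (G′⇒G by)
    ...     | inj₁ refl = ⊥-elim (≉ab e′ (Same-trans e′≈by (inj₂ refl)))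
    ...     | inj₂ refl = there (here (cong c′ (sym (G′.mkEdge-unique e′ _ e′≈by))))

  reduce : ∀ {k} → NoLongCycle → Colorable (Edge G) (LineAdj G) k →
           (G′.NoLongCycle → Colorable (Edge G′) (LineAdj G′) k → Choosable (Edge G′) (LineAdj G′) k) →
           FewNeighbourColours k → Choosable (Edge G) (LineAdj G) k
  reduce noLong colouring smaller few = extend (smaller (noLongCycle′ noLong) (restrict colouring)) few

-- The number of ordered adjacent pairs, which decreases when an edge is deleted.
size : ∀ {n} → SimpleGraph n → ℕ
size G = length (Graph.arcs G)

colorable⇒choosable : ∀ {n} (G : SimpleGraph n) → Graph.NoLongCycle G →
                      ∀ {k} → Colorable (Edge G) (LineAdj G) k → Choosable (Edge G) (LineAdj G) k
colorable⇒choosable {n} = WF.All.wfRec (On.wellFounded size <-wellFounded) _ Claim step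
  where
  Claim : SimpleGraph n → Set
  Claim G = Graph.NoLongCycle G → ∀ {k} → Colorable (Edge G) (LineAdj G) k → Choosable (Edge G) (LineAdj G) k

  step : ∀ G → (∀ {H} → size H < size G → Claim H) → Claim G
  step G smaller noLong colouring with any? (λ u → any? (λ v → Graph.adj? G u v))
  ... | no edgeless = Graph.edgeless-choosable G edgeless
  ... | yes (u , v , uv) with Structure.find-reducible G noLong uv
  ...   | Structure.pendant ab leaf =
    Deletion.reduce G ab noLong colouring (λ noLong′ → smaller (Deletion.fewer-arcs G ab) noLong′)
      (Deletion.pendant-colours G ab colouring leaf)
  ...   | Structure.triangle ab ac bc a-nbrs b-nbrs =
    Deletion.reduce G ab noLong colouring (λ noLong′ → smaller (Deletion.fewer-arcs G ab) noLong′)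
      (Deletion.triangle-colours G ab colouring ac bc a-nbrs b-nbrs)

-- ch(L(G)) = χ(L(G)): the two notions of "least k" coincide because
-- k-choosability and k-colourability of L(G) are equivalent.
corollary4p8 : ∀ {n} (G : SimpleGraph n) →
    (∀ m → 4 ≤ m → ¬ HasCycle G m) →
    ∀ k → IsChoiceNumber (Edge G) (LineAdj G) k ⇔ IsChromaticNumber (Edge G) (LineAdj G) k
corollary4p8 G noLong k = mk⇔
  (λ { (choosable , least) →
         choosable⇒colorable k choosable ,
         λ j colourable → least j (colorable⇒choosable G noLong colourable) })
  (λ { (colourable , least) →
         colorable⇒choosable G noLong colourable ,
         λ j choosable → least j (choosable⇒colorable j choosable) })
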